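{- Let $(G,*)$ be a groupoid satisfying the identities (i) $x(yz)\approx x(zy)$, (ii) $(xy)z\approx(xz)y$, (iii) $w(x(yz))\approx w((xy)z)$, (iv) $(wx)(yz)\approx(w(xy))z$, (v) $w(x(yz))\approx((wx)y)z$. Then $s_n(*)\le2$ and $s^{ac}_n(*)\le2n$ for $n=3,4,\dots$; the first inequality holds as an equality whenever the second does. Both equalities hold for the 2-element groupoid $(\{0,1\},*)$ with $x*y:=x+1\pmod 2$, and for the 3-element groupoids $\mathrm{SC}170$ (rows $0{:}\ 0\,0\,0$; $1{:}\ 0\,2\,1$; $2{:}\ 0\,2\,1$) and $\mathrm{SC}189$ (rows $0{:}\ 0\,0\,0$; $1{:}\ 0\,2\,2$; $2{:}\ 0\,1\,1$).
   Context: A groupoid $(G,*)$ is a set with a binary operation; $xy$ denotes $x*y$. $\mathcal B_n$ is the set of bracketings of the word $x_1x_2\cdots x_n$ (all ways to insert parentheses), and $\mathcal F_n$ is the set of full linear terms, obtained from bracketings by permuting the variables. Each such term $t$ induces an $n$-ary operation $t^*$ on $G$. The associative spectrum is $s_n(*):=|\{t^*:t\in\mathcal B_n\}|$ and the associative-commutative spectrum is $s^{ac}_n(*):=|\{t^*:t\in\mathcal F_n\}|$. A groupoid satisfies an identity if both sides take equal values under every assignment of elements of $G$ to the variables. A 3-element groupoid on $\{0,1,2\}$ is given by its Cayley table; "row $a{:}\ p\,q\,r$" means $a*0=p$, $a*1=q$, $a*2=r$. -}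

module Defs where

open import Data.Nat using (ℕ; zero; suc; _*_; _≤_)
open import Data.Fin using (Fin; zero; suc)
open import Data.List using (List; []; _∷_; _++_; allFin)
open import Data.List.Relation.Binary.Permutation.Propositional using (_↭_)
open import Data.Product using (Σ; ∃; _×_)
open import Relation.Binary.PropositionalEquality using (_≡_; _≢_)
open import Relation.Nullary using (¬_)

-- Terms in the variables x_1 … x_n (variable x_{i+1} is  var i).
data Term (n : ℕ) : Set where
  var : Fin n → Term n
  _·_ : Term n → Term n → Term n

infixl 7 _·_

leaves : ∀ {n} → Term n → List (Fin n)
leaves (var i) = i ∷ []
leaves (s · t) = leaves s ++ leaves t

-- 𝓑_n : bracketings of the word x_1 x_2 ⋯ x_n
IsBracketing : ∀ {n} → Term n → Set
IsBracketing {n} t = leaves t ≡ allFin n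

-- 𝓕_n : full linear terms (bracketings with the variables permuted)
IsFullLinear : ∀ {n} → Term n → Set
IsFullLinear {n} t = leaves t ↭ allFin n

⟦_⟧ : ∀ {A : Set} {n} → Term n → (A → A → A) → (Fin n → A) → A
⟦ var i ⟧ _∙_ a = a i
⟦ s · t ⟧ _∙_ a = (⟦ s ⟧ _∙_ a) ∙ (⟦ t ⟧ _∙_ a)

SameOp : ∀ {A : Set} {n} → (A → A → A) → Term n → Term n → Set
SameOp {A} {n} _∙_ s t = (a : Fin n → A) → ⟦ s ⟧ _∙_ a ≡ ⟦ t ⟧ _∙_ a

-- |{ t^* : t ∈ P }| ≤ k
SpecAtMost : ∀ {A : Set} {n} → (A → A → A) → (Term n → Set) → ℕ → Set
SpecAtMost {A} {n} _∙_ P k =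
  Σ (Fin k → Term n) λ ts → ((i : Fin k) → P (ts i)) ×
    ((t : Term n) → P t → ∃ λ i → SameOp _∙_ t (ts i))

-- |{ t^* : t ∈ P }| ≥ k
SpecAtLeast : ∀ {A : Set} {n} → (A → A → A) → (Term n → Set) → ℕ → Set
SpecAtLeast {A} {n} _∙_ P k =
  Σ (Fin k → Term n) λ ts → ((i : Fin k) → P (ts i)) ×
    ((i j : Fin k) → i ≢ j → ¬ SameOp _∙_ (ts i) (ts j))

SpecEq : ∀ {A : Set} {n} → (A → A → A) → (Term n → Set) → ℕ → Set
SpecEq _∙_ P k = SpecAtMost _∙_ P k × SpecAtLeast _∙_ P k

sₙ≤ sₙ≡ sᵃᶜₙ≤ sᵃᶜₙ≡ : ∀ {A : Set} → (A → A → A) → ℕ → ℕ → Set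
sₙ≤ _∙_ n k = SpecAtMost _∙_ (IsBracketing {n}) k
sₙ≡ _∙_ n k = SpecEq _∙_ (IsBracketing {n}) k
sᵃᶜₙ≤ _∙_ n k = SpecAtMost _∙_ (IsFullLinear {n}) k
sᵃᶜₙ≡ _∙_ n k = SpecEq _∙_ (IsFullLinear {n}) k

Identities : ∀ {A : Set} → (A → A → A) → Set
Identities {A} _∙_ =
  (∀ x y z → x ∙ (y ∙ z) ≡ x ∙ (z ∙ y)) ×
  (∀ x y z → (x ∙ y) ∙ z ≡ (x ∙ z) ∙ y) ×
  (∀ w x y z → w ∙ (x ∙ (y ∙ z)) ≡ w ∙ ((x ∙ y) ∙ z)) ×
  (∀ w x y z → (w ∙ x) ∙ (y ∙ z) ≡ (w ∙ (x ∙ y)) ∙ z) ×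
  (∀ w x y z → w ∙ (x ∙ (y ∙ z)) ≡ ((w ∙ x) ∙ y) ∙ z)

z2op : Fin 2 → Fin 2 → Fin 2
z2op zero       _ = suc zero
z2op (suc zero) _ = zero

sc170 : Fin 3 → Fin 3 → Fin 3
sc170 zero             _                = zero
sc170 (suc _)          zero             = zero
sc170 (suc _)          (suc zero)       = suc (suc zero)
sc170 (suc _)          (suc (suc zero)) = suc zero

sc189 : Fin 3 → Fin 3 → Fin 3
sc189 zero             _       = zero
sc189 (suc _)          zero    = zero
sc189 (suc zero)       (suc _) = suc (suc zero)
sc189 (suc (suc zero)) (suc _) = suc zero

module Submission where

-- Call a and b equal in context if c[a] ≡ c[b] for every context c of the form w ∙ □ or
-- w ∙ (x ∙ □). Identities (i)–(v) make this a congruence under which ∙ is commutative and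
-- associative, since (v) rewrites w ∙ (x ∙ (y ∙ □)) as ((w ∙ x) ∙ y) ∙ □.  Peeling a term
-- along its left spine with (iv) and (v) then shows that its value is v ∙ Π or (v ∙ x) ∙ Π,
-- where v is its leftmost variable, the choice is the parity of the depth of v, and Π is a
-- product, up to that congruence, of the remaining variables.  So a term operation depends
-- only on this parity, the leftmost variable and the multiset of the other variables: at
-- most 2 operations come from bracketings and at most 2n from full linear terms.  In
-- x ∗ y := x + 1 (mod 2) a term computes its leftmost variable shifted by that parity, so
-- all these classes are distinct; SC189 contains this groupoid on {1, 2}, and SC170 is the
-- opposite of SC189.  Finally, if the two bracketing classes coincide, then so do all full
-- linear terms with leftmost variable x₁, and at most 2n − 1 full linear operations remain.

open import Algebra.Bundles using (CommutativeSemigroup)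
open import Algebra.Structures using (IsCommutativeSemigroup)
import Algebra.Properties.CommutativeSemigroup as CommutativeSemigroupProperties
open import Data.Bool using (Bool; true; false; not)
open import Data.Fin using (Fin; zero; suc; combine; remQuot; opposite)
open import Data.Fin.Properties
  using (2↔Bool; combine-injective; combine-remQuot; pigeonhole; <⇒≢; opposite-involutive; all?)
  renaming (_≟_ to _≟ᶠ_; suc-injective to fsuc-injective)
open import Data.List using (List; []; _∷_; _++_; map; reverse; length; allFin)
open import Data.List.Properties
  using (map-++; reverse-++; ∷-injectiveˡ; length-tabulate; length-reverse; reverse-involutive)
open import Data.List.Membership.Propositional using (_∈_)
open import Data.List.Membership.Propositional.Properties using (∈-∃++; ∈-allFin)
open import Data.List.Relation.Binary.Permutation.Propositional
  using (_↭_; prep; swap; ↭-trans; ↭-reflexive; ↭-sym)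
import Data.List.Relation.Binary.Permutation.Propositional as ↭
open import Data.List.Relation.Binary.Permutation.Propositional.Properties
  using (map⁺; drop-∷; shift; ↭-length; ↭-reverse)
open import Data.Nat using (ℕ; suc; _≤_; _*_; s≤s)
open import Data.Nat.Properties using (≮⇒≥; n≮n; *-suc)
open import Data.Product using (Σ-syntax; _×_; _,_; proj₁; proj₂; uncurry)
open import Data.Sum using (_⊎_; inj₁; inj₂)
open import Function using (_∘_; id)
open import Function.Bundles using (Inverse)
open import Function.Definitions using (Injective)
open import Level using (0ℓ)
open import Relation.Binary.PropositionalEquality
  using (_≡_; _≢_; refl; sym; trans; cong; cong₂; subst; module ≡-Reasoning)
open import Relation.Nullary using (¬_; yes; no; contradiction)
open import Relation.Nullary.Decidable using (Dec; does; dec-true; dec-false; from-yes; _×-dec_)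

open import Defs

parity : ∀ {n} → Term n → Bool
parity (var _) = false
parity (s · _) = not (parity s)

first : ∀ {n} → Term n → Fin n
first (var i) = i
first (s · _) = first s

rest : ∀ {n} → Term n → List (Fin n)
rest (var _) = []
rest (s · u) = rest s ++ first u ∷ rest u

HasLeaves : ∀ {n} → List (Fin n) → Term n → Set
HasLeaves w t = leaves t ≡ w

leaves≡first∷rest : ∀ {n} (t : Term n) → leaves t ≡ first t ∷ rest t
leaves≡first∷rest (var i) = refl
leaves≡first∷rest (s · u) rewrite leaves≡first∷rest s | leaves≡first∷rest u = refl

first-of-leaves : ∀ {n} {t : Term n} {x l} → leaves t ≡ x ∷ l → first t ≡ x
first-of-leaves {t = t} eq = ∷-injectiveˡ (trans (sym (leaves≡first∷rest t)) eq)

rest-↭ : ∀ {n} {s t : Term n} → first s ≡ first t → leaves s ↭ leaves t → rest s ↭ rest t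
rest-↭ {s = s} {t} first≡ p
  rewrite leaves≡first∷rest s | leaves≡first∷rest t | first≡ = drop-∷ p

data Shape {X : Set} : Bool → List X → Set where
  even-[] : Shape false []
  odd-∷   : ∀ {x l} → Shape true (x ∷ l)
  even-∷∷ : ∀ {x y l} → Shape false (x ∷ y ∷ l)

shape : ∀ {n} (t : Term n) → Shape (parity t) (rest t)
shape (var _) = even-[]
shape (s · u) with parity s | rest s | shape s
... | false | []        | even-[] = odd-∷
... | true  | _ ∷ []    | odd-∷   = even-∷∷
... | true  | _ ∷ _ ∷ _ | odd-∷   = even-∷∷
... | false | _ ∷ _ ∷ _ | even-∷∷ = odd-∷

mirror : ∀ {n} → Term n → Term n
mirror (var i) = var i
mirror (s · u) = mirror u · mirror s

leaves-mirror : ∀ {n} (t : Term n) → leaves (mirror t) ≡ reverse (leaves t)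
leaves-mirror (var i) = refl
leaves-mirror (s · u)
  rewrite leaves-mirror s | leaves-mirror u = sym (reverse-++ (leaves s) (leaves u))

comb : ∀ {n} → Fin n → List (Fin n) → Term n
comb x []      = var x
comb x (y ∷ l) = var x · comb y l

leaves-comb : ∀ {n} (x : Fin n) l → leaves (comb x l) ≡ x ∷ l
leaves-comb x []      = refl
leaves-comb x (y ∷ l) = cong (x ∷_) (leaves-comb y l)

termWith : ∀ {n} (p : Bool) (w : List (Fin n)) → 3 ≤ length w →
           Σ[ t ∈ Term n ] HasLeaves w t × parity t ≡ p
termWith true  (a ∷ b ∷ c ∷ r) _ =
  var a · comb b (c ∷ r) , cong (a ∷_) (leaves-comb b (c ∷ r)) , refl
termWith false (a ∷ b ∷ c ∷ r) _ =
  (var a · var b) · comb c r , cong (λ l → a ∷ b ∷ l) (leaves-comb c r) , refl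
termWith _ []           ()
termWith _ (_ ∷ [])     (s≤s ())
termWith _ (_ ∷ _ ∷ []) (s≤s (s≤s ()))

⟦mirror⟧ : ∀ {A : Set} {_∙_ _⋆_ : A → A → A} → (∀ x y → x ⋆ y ≡ y ∙ x) →
           ∀ {n} (t : Term n) ρ → ⟦ mirror t ⟧ _⋆_ ρ ≡ ⟦ t ⟧ _∙_ ρ
⟦mirror⟧ ⋆-flip (var i) ρ = refl
⟦mirror⟧ {_⋆_ = _⋆_} ⋆-flip (s · u) ρ =
  trans (cong₂ _⋆_ (⟦mirror⟧ ⋆-flip u ρ) (⟦mirror⟧ ⋆-flip s ρ)) (⋆-flip _ _)

⟦⟧-homomorphic : ∀ {A B : Set} {_∙_ : A → A → A} {_⋆_ : B → B → B} (h : A → B) →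
                 (∀ x y → h (x ∙ y) ≡ h x ⋆ h y) →
                 ∀ {n} (t : Term n) ρ → ⟦ t ⟧ _⋆_ (h ∘ ρ) ≡ h (⟦ t ⟧ _∙_ ρ)
⟦⟧-homomorphic h hom (var i) ρ = refl
⟦⟧-homomorphic {_⋆_ = _⋆_} h hom (s · u) ρ =
  trans (cong₂ _⋆_ (⟦⟧-homomorphic h hom s ρ) (⟦⟧-homomorphic h hom u ρ)) (sym (hom _ _))

SameOp-reflect : ∀ {A B : Set} {_∙_ : A → A → A} {_⋆_ : B → B → B} (h : A → B) →
                 Injective _≡_ _≡_ h → (∀ x y → h (x ∙ y) ≡ h x ⋆ h y) →
                 ∀ {n} (s t : Term n) → SameOp _⋆_ s t → SameOp _∙_ s t
SameOp-reflect h h-injective hom s t same ρ = h-injective (begin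
  h (⟦ s ⟧ _ ρ)     ≡⟨ ⟦⟧-homomorphic h hom s ρ ⟨
  ⟦ s ⟧ _ (h ∘ ρ)   ≡⟨ same (h ∘ ρ) ⟩
  ⟦ t ⟧ _ (h ∘ ρ)   ≡⟨ ⟦⟧-homomorphic h hom t ρ ⟩
  h (⟦ t ⟧ _ ρ)     ∎)
  where open ≡-Reasoning

module _ {A B : Set} (g : List A → B)
         (g-tail : ∀ x {l m} → l ↭ m → g (x ∷ l) ≡ g (x ∷ m))
         (g-swap : ∀ x y l → g (x ∷ y ∷ l) ≡ g (y ∷ x ∷ l)) where

  preserves-↭ : ∀ {xs ys} → xs ↭ ys → g xs ≡ g ys
  preserves-↭ ↭.refl        = refl
  preserves-↭ (prep x p)    = g-tail x p
  preserves-↭ (swap x y p)  = trans (g-swap x y _) (g-tail y (prep x p))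
  preserves-↭ (↭.trans p q) = trans (preserves-↭ p) (preserves-↭ q)

∈⇒∷↭ : ∀ {A : Set} {x : A} {xs} → x ∈ xs → Σ[ ys ∈ List A ] x ∷ ys ↭ xs
∈⇒∷↭ {x = x} x∈xs with ys , zs , eq ← ∈-∃++ x∈xs =
  ys ++ zs , ↭-trans (↭-sym (shift x ys zs)) (↭-reflexive (sym eq))

3≤∣allFin∣ : ∀ {n} → 3 ≤ n → 3 ≤ length (allFin n)
3≤∣allFin∣ {n} = subst (3 ≤_) (sym (length-tabulate {n = n} id))

module Product {ℓ} (S : CommutativeSemigroup 0ℓ ℓ) where
  open CommutativeSemigroup S hiding (refl; sym; trans)
  open CommutativeSemigroup S using () renaming (refl to ≈-refl; trans to ≈-trans)
  open CommutativeSemigroupProperties S using (x∙yz≈y∙xz)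
  open import Relation.Binary.Reasoning.Setoid setoid

  Π : Carrier → List Carrier → Carrier
  Π x []      = x
  Π x (y ∷ l) = x ∙ Π y l

  Π-exchange : ∀ x y l → Π x (y ∷ l) ≈ Π y (x ∷ l)
  Π-exchange x y []      = comm x y
  Π-exchange x y (z ∷ l) = x∙yz≈y∙xz x y (Π z l)

  Π-↭ : ∀ x {l m} → l ↭ m → Π x l ≈ Π x m
  Π-↭ x ↭.refl                = ≈-refl
  Π-↭ x (prep y p)            = ∙-congˡ (Π-↭ y p)
  Π-↭ x (swap {xs = l} y z p) = ∙-congˡ (≈-trans (Π-exchange y z l) (∙-congˡ (Π-↭ y p)))
  Π-↭ x (↭.trans p q)         = ≈-trans (Π-↭ x p) (Π-↭ x q)

  Π-++ : ∀ x l y m → Π x l ∙ Π y m ≈ Π x (l ++ y ∷ m)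
  Π-++ x []      y m = ≈-refl
  Π-++ x (z ∷ l) y m = ≈-trans (assoc x (Π z l) (Π y m)) (∙-congˡ (Π-++ z l y m))

  ⟦⟧≈Π : ∀ {n} (t : Term n) (ρ : Fin n → Carrier) →
         ⟦ t ⟧ _∙_ ρ ≈ Π (ρ (first t)) (map ρ (rest t))
  ⟦⟧≈Π (var i) ρ = ≈-refl
  ⟦⟧≈Π (s · u) ρ = begin
    ⟦ s ⟧ _∙_ ρ ∙ ⟦ u ⟧ _∙_ ρ
      ≈⟨ ∙-cong (⟦⟧≈Π s ρ) (⟦⟧≈Π u ρ) ⟩
    Π (ρ (first s)) (map ρ (rest s)) ∙ Π (ρ (first u)) (map ρ (rest u))
      ≈⟨ Π-++ _ (map ρ (rest s)) _ _ ⟩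
    Π (ρ (first s)) (map ρ (rest s) ++ ρ (first u) ∷ map ρ (rest u))
      ≡⟨ cong (Π _) (map-++ ρ (rest s) _) ⟨
    Π (ρ (first s)) (map ρ (rest s ++ first u ∷ rest u)) ∎

-- The normal form of a term under identities (i)–(v)

module NormalForm {A : Set} (_∙_ : A → A → A) (ids : Identities _∙_) where
  private
    law₁ : ∀ x y z → x ∙ (y ∙ z) ≡ x ∙ (z ∙ y)
    law₁ = proj₁ ids
    law₂ : ∀ x y z → (x ∙ y) ∙ z ≡ (x ∙ z) ∙ y
    law₂ = proj₁ (proj₂ ids)
    law₃ : ∀ w x y z → w ∙ (x ∙ (y ∙ z)) ≡ w ∙ ((x ∙ y) ∙ z)
    law₃ = proj₁ (proj₂ (proj₂ ids))
    law₄ : ∀ w x y z → (w ∙ x) ∙ (y ∙ z) ≡ (w ∙ (x ∙ y)) ∙ z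
    law₄ = proj₁ (proj₂ (proj₂ (proj₂ ids)))
    law₅ : ∀ w x y z → w ∙ (x ∙ (y ∙ z)) ≡ ((w ∙ x) ∙ y) ∙ z
    law₅ = proj₂ (proj₂ (proj₂ (proj₂ ids)))

  data Context : Set where
    _∙□     : A → Context
    _∙⟨_∙□⟩ : A → A → Context

  plug : Context → A → A
  plug (w ∙□)      s = w ∙ s
  plug (w ∙⟨ x ∙□⟩) s = w ∙ (x ∙ s)

  extend : A → Context → Context
  extend y (w ∙□)      = w ∙⟨ y ∙□⟩
  extend y (w ∙⟨ x ∙□⟩) = ((w ∙ x) ∙ y) ∙□

  plug-extend : ∀ c y s → plug (extend y c) s ≡ plug c (y ∙ s)
  plug-extend (w ∙□)      y s = refl
  plug-extend (w ∙⟨ x ∙□⟩) y s = sym (law₅ w x y s)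

  plug-comm : ∀ c x y → plug c (x ∙ y) ≡ plug c (y ∙ x)
  plug-comm (w ∙□)      x y = law₁ w x y
  plug-comm (w ∙⟨ v ∙□⟩) x y = begin
    w ∙ (v ∙ (x ∙ y))   ≡⟨ law₅ w v x y ⟩
    ((w ∙ v) ∙ x) ∙ y   ≡⟨ law₂ (w ∙ v) x y ⟩
    ((w ∙ v) ∙ y) ∙ x   ≡⟨ law₅ w v y x ⟨
    w ∙ (v ∙ (y ∙ x))   ∎
    where open ≡-Reasoning

  plug-assoc : ∀ c x y z → plug c (x ∙ (y ∙ z)) ≡ plug c ((x ∙ y) ∙ z)
  plug-assoc (w ∙□)      x y z = law₃ w x y z
  plug-assoc (w ∙⟨ v ∙□⟩) x y z = begin
    w ∙ (v ∙ (x ∙ (y ∙ z)))   ≡⟨ law₅ w v x (y ∙ z) ⟩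
    ((w ∙ v) ∙ x) ∙ (y ∙ z)   ≡⟨ law₄ (w ∙ v) x y z ⟩
    ((w ∙ v) ∙ (x ∙ y)) ∙ z   ≡⟨ law₅ w v (x ∙ y) z ⟨
    w ∙ (v ∙ ((x ∙ y) ∙ z))   ∎
    where open ≡-Reasoning

  infix 4 _≈_
  _≈_ : A → A → Set
  a ≈ b = ∀ c → plug c a ≡ plug c b

  ≈-∙-cong : ∀ {a a′ b b′} → a ≈ a′ → b ≈ b′ → a ∙ b ≈ a′ ∙ b′
  ≈-∙-cong {a} {a′} {b} {b′} a≈a′ b≈b′ c = begin
    plug c (a ∙ b)          ≡⟨ plug-extend c a b ⟨
    plug (extend a c) b     ≡⟨ b≈b′ (extend a c) ⟩
    plug (extend a c) b′    ≡⟨ plug-extend c a b′ ⟩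
    plug c (a ∙ b′)         ≡⟨ plug-comm c a b′ ⟩
    plug c (b′ ∙ a)         ≡⟨ plug-extend c b′ a ⟨
    plug (extend b′ c) a    ≡⟨ a≈a′ (extend b′ c) ⟩
    plug (extend b′ c) a′   ≡⟨ plug-extend c b′ a′ ⟩
    plug c (b′ ∙ a′)        ≡⟨ plug-comm c b′ a′ ⟩
    plug c (a′ ∙ b′)        ∎
    where open ≡-Reasoning

  ≈-isCommutativeSemigroup : IsCommutativeSemigroup _≈_ _∙_
  ≈-isCommutativeSemigroup = record
    { isSemigroup = record
      { isMagma = record
        { isEquivalence = record
          { refl  = λ _ → refl
          ; sym   = λ p c → sym (p c)
          ; trans = λ p q c → trans (p c) (q c)
          }
        ; ∙-cong = ≈-∙-cong
        }
      ; assoc = λ x y z c → sym (plug-assoc c x y z)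
      }
    ; comm = λ x y c → plug-comm c x y
    }

  ≈-commutativeSemigroup : CommutativeSemigroup _ _
  ≈-commutativeSemigroup = record { isCommutativeSemigroup = ≈-isCommutativeSemigroup }

  open Product ≈-commutativeSemigroup using (Π; Π-exchange; Π-↭; Π-++; ⟦⟧≈Π)

  infixl 7 _∙Π_
  _∙Π_ : A → List A → A
  w ∙Π []      = w
  w ∙Π (x ∷ l) = w ∙ Π x l

  ∙Π-↭ : ∀ w {l m} → l ↭ m → w ∙Π l ≡ w ∙Π m
  ∙Π-↭ w = preserves-↭ (w ∙Π_) (λ x p → Π-↭ x p (w ∙□)) (λ x y l → Π-exchange x y l (w ∙□))

  -- By `shape`, ⟦⟧≡nf never meets nf true v [] or nf false v (x ∷ []).
  nf : Bool → A → List A → A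
  nf true  v l       = v ∙Π l
  nf false v []      = v
  nf false v (x ∷ l) = (v ∙ x) ∙Π l

  even-swap : ∀ v x y l → (v ∙ x) ∙Π (y ∷ l) ≡ (v ∙ y) ∙Π (x ∷ l)
  even-swap v x y []      = law₂ v x y
  even-swap v x y (z ∷ l) = begin
    (v ∙ x) ∙ (y ∙ Π z l)   ≡⟨ law₄ v x y (Π z l) ⟩
    (v ∙ (x ∙ y)) ∙ Π z l   ≡⟨ cong (_∙ Π z l) (law₁ v x y) ⟩
    (v ∙ (y ∙ x)) ∙ Π z l   ≡⟨ law₄ v y x (Π z l) ⟨
    (v ∙ y) ∙ (x ∙ Π z l)   ∎
    where open ≡-Reasoning

  nf-↭ : ∀ p v {l m} → l ↭ m → nf p v l ≡ nf p v m
  nf-↭ true  v = ∙Π-↭ v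
  nf-↭ false v = preserves-↭ (nf false v) (λ x → ∙Π-↭ (v ∙ x)) (even-swap v)

  Π∙≈Π : ∀ z l {X} y m → X ≈ Π y m → Π z l ∙ X ≈ Π z (l ++ y ∷ m)
  Π∙≈Π z l y m X≈ c = trans (≈-∙-cong {Π z l} (λ _ → refl) X≈ c) (Π-++ z l y m c)

  odd-step : ∀ v x l {X} y m → X ≈ Π y m → (v ∙Π (x ∷ l)) ∙ X ≡ (v ∙ x) ∙Π (l ++ y ∷ m)
  odd-step v x []      y m X≈ = X≈ ((v ∙ x) ∙□)
  odd-step v x (z ∷ l) {X} y m X≈ =
    trans (sym (law₄ v x (Π z l) X)) (Π∙≈Π z l y m X≈ ((v ∙ x) ∙□))

  even-step : ∀ v x z l {X} y m → X ≈ Π y m →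
              ((v ∙ x) ∙Π (z ∷ l)) ∙ X ≡ v ∙Π (x ∷ z ∷ l ++ y ∷ m)
  even-step v x z l {X} y m X≈ =
    trans (sym (law₅ v x (Π z l) X)) (Π∙≈Π z l y m X≈ (v ∙⟨ x ∙□⟩))

  ⟦⟧≡nf : ∀ {n} (t : Term n) ρ → ⟦ t ⟧ _∙_ ρ ≡ nf (parity t) (ρ (first t)) (map ρ (rest t))
  ⟦⟧≡nf (var i) ρ = refl
  ⟦⟧≡nf (s · u) ρ with parity s | rest s | shape s | ⟦⟧≡nf s ρ
  ... | false | [] | even-[] | eq =
    trans (cong (_∙ ⟦ u ⟧ _∙_ ρ) eq) (⟦⟧≈Π u ρ (ρ (first s) ∙□))
  ... | true | x ∷ l | odd-∷ | eq = begin
    ⟦ s ⟧ _∙_ ρ ∙ ⟦ u ⟧ _∙_ ρ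
      ≡⟨ cong (_∙ ⟦ u ⟧ _∙_ ρ) eq ⟩
    (v ∙Π (ρ x ∷ map ρ l)) ∙ ⟦ u ⟧ _∙_ ρ
      ≡⟨ odd-step v (ρ x) (map ρ l) _ _ (⟦⟧≈Π u ρ) ⟩
    (v ∙ ρ x) ∙Π (map ρ l ++ ρ (first u) ∷ map ρ (rest u))
      ≡⟨ cong ((v ∙ ρ x) ∙Π_) (map-++ ρ l _) ⟨
    (v ∙ ρ x) ∙Π map ρ (l ++ first u ∷ rest u) ∎
    where open ≡-Reasoning
          v = ρ (first s)
  ... | false | x ∷ y ∷ l | even-∷∷ | eq = begin
    ⟦ s ⟧ _∙_ ρ ∙ ⟦ u ⟧ _∙_ ρ
      ≡⟨ cong (_∙ ⟦ u ⟧ _∙_ ρ) eq ⟩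
    ((v ∙ ρ x) ∙Π (ρ y ∷ map ρ l)) ∙ ⟦ u ⟧ _∙_ ρ
      ≡⟨ even-step v (ρ x) (ρ y) (map ρ l) _ _ (⟦⟧≈Π u ρ) ⟩
    v ∙Π (ρ x ∷ ρ y ∷ map ρ l ++ ρ (first u) ∷ map ρ (rest u))
      ≡⟨ cong (λ m → v ∙Π (ρ x ∷ ρ y ∷ m)) (map-++ ρ l _) ⟨
    v ∙Π (ρ x ∷ ρ y ∷ map ρ (l ++ first u ∷ rest u)) ∎
    where open ≡-Reasoning
          v = ρ (first s)

  sameOp : ∀ {n} (s t : Term n) → parity s ≡ parity t → first s ≡ first t →
           leaves s ↭ leaves t → SameOp _∙_ s t
  sameOp s t parity≡ first≡ leaves↭ ρ = begin
    ⟦ s ⟧ _∙_ ρ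
      ≡⟨ ⟦⟧≡nf s ρ ⟩
    nf (parity s) (ρ (first s)) (map ρ (rest s))
      ≡⟨ cong₂ (λ p v → nf p v (map ρ (rest s))) parity≡ (cong ρ first≡) ⟩
    nf (parity t) (ρ (first t)) (map ρ (rest s))
      ≡⟨ nf-↭ (parity t) _ (map⁺ ρ (rest-↭ {s = s} {t} first≡ leaves↭)) ⟩
    nf (parity t) (ρ (first t)) (map ρ (rest t))
      ≡⟨ ⟦⟧≡nf t ρ ⟨
    ⟦ t ⟧ _∙_ ρ ∎
    where open ≡-Reasoning

-- Counting term operations through an invariant

module _ {n} (P : Term n → Set) {k} (inv : Term n → Fin k) where

  Section : Set
  Section = (i : Fin k) → Σ[ t ∈ Term n ] P t × inv t ≡ i

module _ {A : Set} (_∙_ : A → A → A) {n} (P : Term n → Set) {k} (inv : Term n → Fin k) where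

  Classifies Separates : Set
  Classifies = ∀ s t → P s → P t → inv s ≡ inv t → SameOp _∙_ s t
  Separates  = ∀ s t → SameOp _∙_ s t → inv s ≡ inv t

  module _ (section : Section P inv) where
    private
      rep : Fin k → Term n
      rep i = proj₁ (section i)
      P-rep : ∀ i → P (rep i)
      P-rep i = proj₁ (proj₂ (section i))
      inv-rep : ∀ i → inv (rep i) ≡ i
      inv-rep i = proj₂ (proj₂ (section i))

    atMost : Classifies → SpecAtMost _∙_ P k
    atMost classifies = rep , P-rep , λ t Pt →
      inv t , classifies t (rep (inv t)) Pt (P-rep (inv t)) (sym (inv-rep (inv t)))

    atLeast : Separates → SpecAtLeast _∙_ P k
    atLeast separates = rep , P-rep , λ i j i≢j same →
      i≢j (trans (sym (inv-rep i)) (trans (separates (rep i) (rep j) same) (inv-rep j)))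

  atLeast⇒≤ : Classifies → ∀ {k′} → SpecAtLeast _∙_ P k′ → k′ ≤ k
  atLeast⇒≤ classifies (ts , P-ts , distinct) = ≮⇒≥ λ k<k′ →
    let i , j , i<j , inv≡ = pigeonhole k<k′ (inv ∘ ts)
    in distinct i j (<⇒≢ i<j) (classifies (ts i) (ts j) (P-ts i) (P-ts j) inv≡)

atLeast-pair : ∀ {A : Set} {_∙_ : A → A → A} {n} {P : Term n → Set} (s t : Term n) →
               P s → P t → ¬ SameOp _∙_ s t → SpecAtLeast _∙_ P 2
atLeast-pair {n = n} {P} s t Ps Pt s≉t = pair , P-pair , distinct
  where
  pair : Fin 2 → Term n
  pair zero       = s
  pair (suc zero) = t
  P-pair : ∀ i → P (pair i)
  P-pair zero       = Ps
  P-pair (suc zero) = Pt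
  distinct : ∀ i j → i ≢ j → ¬ SameOp _ (pair i) (pair j)
  distinct zero       zero       i≢j = contradiction refl i≢j
  distinct zero       (suc zero) _   = s≉t
  distinct (suc zero) zero       _   = λ same → s≉t λ ρ → sym (same ρ)
  distinct (suc zero) (suc zero) i≢j = contradiction refl i≢j

bool : Fin 2 → Bool
bool = Inverse.to 2↔Bool

bit : Bool → Fin 2
bit = Inverse.from 2↔Bool

bit-injective : ∀ {p q} → bit p ≡ bit q → p ≡ q
bit-injective {p} {q} eq = begin
  p              ≡⟨ Inverse.strictlyInverseˡ 2↔Bool p ⟨
  bool (bit p)   ≡⟨ cong bool eq ⟩
  bool (bit q)   ≡⟨ Inverse.strictlyInverseˡ 2↔Bool q ⟩
  q              ∎
  where open ≡-Reasoning

parityBit : ∀ {n} → Term n → Fin 2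
parityBit t = bit (parity t)

shapeCode : ∀ {n} → Term n → Fin (2 * n)
shapeCode t = combine (parityBit t) (first t)

bracketing-section : ∀ {n} (w : List (Fin n)) → 3 ≤ length w → Section (HasLeaves w) parityBit
bracketing-section w 3≤∣w∣ i with termWith (bool i) w 3≤∣w∣
... | t , t∈ , parity≡ = t , t∈ , trans (cong bit parity≡) (Inverse.strictlyInverseʳ 2↔Bool i)

fullLinearWith : ∀ {n} (p : Bool) (v : Fin n) → 3 ≤ n →
                 Σ[ t ∈ Term n ] IsFullLinear t × parity t ≡ p × first t ≡ v
fullLinearWith {n} p v 3≤n with ∈⇒∷↭ (∈-allFin v)
... | l , v∷l↭ with termWith p (v ∷ l) (subst (3 ≤_) (sym (↭-length v∷l↭)) (3≤∣allFin∣ 3≤n))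
... | t , t∈ , parity≡ = t , ↭-trans (↭-reflexive t∈) v∷l↭ , parity≡ , first-of-leaves {t = t} t∈

fullLinear-section : ∀ {n} → 3 ≤ n → Section (IsFullLinear {n}) shapeCode
fullLinear-section {n} 3≤n i with remQuot {2} n i in quotient≡
... | c , v with fullLinearWith (bool c) v 3≤n
... | t , t∈ , parity≡ , first≡ = t , t∈ , (begin
  combine (bit (parity t)) (first t)
    ≡⟨ cong₂ combine (trans (cong bit parity≡) (Inverse.strictlyInverseʳ 2↔Bool c)) first≡ ⟩
  combine c v
    ≡⟨ cong (uncurry combine) quotient≡ ⟨
  uncurry combine (remQuot {2} n i)
    ≡⟨ combine-remQuot {2} n i ⟩
  i ∎)
  where open ≡-Reasoning

collapse : ∀ {k} → Bool → Fin (suc k) → Fin (suc (2 * k))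
collapse p zero    = zero
collapse p (suc v) = suc (combine (bit p) v)

collapse-injective : ∀ {k p q} {v w : Fin (suc k)} → collapse p v ≡ collapse q w →
                     (v ≡ zero × w ≡ zero) ⊎ (p ≡ q × v ≡ w)
collapse-injective {v = zero}  {zero}  _  = inj₁ (refl , refl)
collapse-injective {v = suc v} {suc w} eq =
  let bits≡ , v≡w = combine-injective _ _ _ _ (fsuc-injective eq)
  in inj₂ (bit-injective bits≡ , cong suc v≡w)

module Bounds {A : Set} (_∙_ : A → A → A) (ids : Identities _∙_) where
  open NormalForm _∙_ ids using (sameOp)

  bracketing-classifies : ∀ {n} (w : List (Fin n)) → Classifies _∙_ (HasLeaves w) parityBit
  bracketing-classifies w s t s∈ t∈ bits≡ =
    sameOp s t (bit-injective bits≡) (first-of-leaves {t = s} leaves≡) (↭-reflexive (trans s∈ (sym t∈)))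
    where
    leaves≡ : leaves s ≡ first t ∷ rest t
    leaves≡ = trans s∈ (trans (sym t∈) (leaves≡first∷rest t))

  fullLinear-classifies : ∀ {n} → Classifies _∙_ (IsFullLinear {n}) shapeCode
  fullLinear-classifies s t s∈ t∈ codes≡ =
    let bits≡ , first≡ = combine-injective _ _ _ _ codes≡
    in sameOp s t (bit-injective bits≡) first≡ (↭-trans s∈ (↭-sym t∈))

  bracketings-atMost : ∀ {n} (w : List (Fin n)) → 3 ≤ length w → SpecAtMost _∙_ (HasLeaves w) 2
  bracketings-atMost w 3≤∣w∣ =
    atMost _∙_ (HasLeaves w) parityBit (bracketing-section w 3≤∣w∣) (bracketing-classifies w)

  fullLinear-atMost : ∀ {n} → 3 ≤ n → SpecAtMost _∙_ (IsFullLinear {n}) (2 * n)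
  fullLinear-atMost 3≤n =
    atMost _∙_ IsFullLinear shapeCode (fullLinear-section 3≤n) fullLinear-classifies

  module _ {k} (3≤n : 3 ≤ suc k) where
    private
      n = suc k

    bracketing : Bool → Term n
    bracketing p = proj₁ (termWith p (allFin n) (3≤∣allFin∣ 3≤n))

    bracketing-leaves : ∀ p → HasLeaves (allFin n) (bracketing p)
    bracketing-leaves p = proj₁ (proj₂ (termWith p (allFin n) (3≤∣allFin∣ 3≤n)))

    bracketing-parity : ∀ p → parity (bracketing p) ≡ p
    bracketing-parity p = proj₂ (proj₂ (termWith p (allFin n) (3≤∣allFin∣ 3≤n)))

    -- If the two bracketings agree, so does every full linear term with first leaf zero,
    -- and `collapse` classifies the full linear terms by 2n − 1 values.
    bracketings-differ : SpecAtLeast _∙_ (IsFullLinear {n}) (2 * n) →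
                         ¬ SameOp _∙_ (bracketing true) (bracketing false)
    bracketings-differ atLeast-2n same = n≮n _
      (subst (_≤ suc (2 * k)) (*-suc 2 k)
        (atLeast⇒≤ _∙_ IsFullLinear (λ t → collapse (parity t) (first t)) classifies atLeast-2n))
      where
      to-bracketing : ∀ t → IsFullLinear t → first t ≡ zero → SameOp _∙_ t (bracketing true)
      to-bracketing t t∈ first≡ ρ = trans (t≈b ρ) (b≈true (parity t) ρ)
        where
        t≈b : SameOp _∙_ t (bracketing (parity t))
        t≈b = sameOp t (bracketing (parity t)) (sym (bracketing-parity (parity t)))
                     (trans first≡ (sym (first-of-leaves {t = bracketing (parity t)}
                                                         (bracketing-leaves (parity t)))))
                     (↭-trans t∈ (↭-sym (↭-reflexive (bracketing-leaves (parity t)))))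
        b≈true : ∀ p → SameOp _∙_ (bracketing p) (bracketing true)
        b≈true true  ρ = refl
        b≈true false ρ = sym (same ρ)

      classifies : Classifies _∙_ IsFullLinear (λ t → collapse (parity t) (first t))
      classifies s t s∈ t∈ codes≡ with collapse-injective codes≡
      ... | inj₁ (s₀ , t₀) =
        λ ρ → trans (to-bracketing s s∈ s₀ ρ) (sym (to-bracketing t t∈ t₀ ρ))
      ... | inj₂ (parity≡ , first≡) =
        sameOp s t parity≡ first≡ (↭-trans s∈ (↭-sym t∈))

  bounds : ∀ n → 3 ≤ n →
           sₙ≤ _∙_ n 2 × sᵃᶜₙ≤ _∙_ n (2 * n) × (sᵃᶜₙ≡ _∙_ n (2 * n) → sₙ≡ _∙_ n 2)
  bounds (suc k) 3≤n =
    bracketings-atMost (allFin (suc k)) (3≤∣allFin∣ 3≤n) ,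
    fullLinear-atMost 3≤n ,
    λ (_ , atLeast-2n) →
      bracketings-atMost (allFin (suc k)) (3≤∣allFin∣ 3≤n) ,
      atLeast-pair {P = HasLeaves (allFin (suc k))} (bracketing 3≤n true) (bracketing 3≤n false)
        (bracketing-leaves 3≤n true) (bracketing-leaves 3≤n false)
        (bracketings-differ 3≤n atLeast-2n)

-- Groupoids in which all these bounds are attained

identities? : ∀ {k} (_∙_ : Fin k → Fin k → Fin k) → Dec (Identities _∙_)
identities? _∙_ =
  all? (λ x → all? λ y → all? λ z → x ∙ (y ∙ z) ≟ᶠ x ∙ (z ∙ y)) ×-dec
  all? (λ x → all? λ y → all? λ z → (x ∙ y) ∙ z ≟ᶠ (x ∙ z) ∙ y) ×-dec
  all? (λ w → all? λ x → all? λ y → all? λ z → w ∙ (x ∙ (y ∙ z)) ≟ᶠ w ∙ ((x ∙ y) ∙ z)) ×-dec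
  all? (λ w → all? λ x → all? λ y → all? λ z → (w ∙ x) ∙ (y ∙ z) ≟ᶠ (w ∙ (x ∙ y)) ∙ z) ×-dec
  all? (λ w → all? λ x → all? λ y → all? λ z → w ∙ (x ∙ (y ∙ z)) ≟ᶠ ((w ∙ x) ∙ y) ∙ z)

flipIf : Bool → Fin 2 → Fin 2
flipIf false x = x
flipIf true  x = opposite x

flipIf-injective : ∀ p {x y} → flipIf p x ≡ flipIf p y → x ≡ y
flipIf-injective false eq = eq
flipIf-injective true {x} {y} eq =
  trans (sym (opposite-involutive x)) (trans (cong opposite eq) (opposite-involutive y))

⟦⟧-z2op : ∀ {n} (t : Term n) σ → ⟦ t ⟧ z2op σ ≡ flipIf (parity t) (σ (first t))
⟦⟧-z2op (var i) σ = refl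
⟦⟧-z2op (s · u) σ = trans (z2op≡opposite _ (⟦ u ⟧ z2op σ)) (opposite-flipIf (parity s) (⟦⟧-z2op s σ))
  where
  z2op≡opposite : ∀ x y → z2op x y ≡ opposite x
  z2op≡opposite zero       _ = refl
  z2op≡opposite (suc zero) _ = refl
  opposite-flipIf : ∀ p {x y} → x ≡ flipIf p y → opposite x ≡ flipIf (not p) y
  opposite-flipIf false refl = refl
  opposite-flipIf true  refl = opposite-involutive _

z2op-separates : ∀ {n} (s t : Term n) → SameOp z2op s t → parity s ≡ parity t × first s ≡ first t
z2op-separates {n} s t same = parity≡ , first≡
  where
  values : ∀ σ → flipIf (parity s) (σ (first s)) ≡ flipIf (parity t) (σ (first t))
  values σ = trans (sym (⟦⟧-z2op s σ)) (trans (same σ) (⟦⟧-z2op t σ))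

  parity≡ : parity s ≡ parity t
  parity≡ with parity s | parity t | values (λ _ → zero)
  ... | false | false | _  = refl
  ... | true  | true  | _  = refl
  ... | false | true  | ()
  ... | true  | false | ()

  indicator : Fin n → Fin 2
  indicator i = bit (does (i ≟ᶠ first s))

  indicator≡ : indicator (first s) ≡ indicator (first t)
  indicator≡ = flipIf-injective (parity t)
    (subst (λ p → flipIf p (indicator (first s)) ≡ flipIf (parity t) (indicator (first t)))
           parity≡ (values indicator))

  first≡ : first s ≡ first t
  first≡ with first s ≟ᶠ first t
  ... | yes eq = eq
  ... | no neq = contradiction (begin
    true                       ≡⟨ dec-true (first s ≟ᶠ first s) refl ⟨
    does (first s ≟ᶠ first s)  ≡⟨ bit-injective indicator≡ ⟩
    does (first t ≟ᶠ first s)  ≡⟨ dec-false (first t ≟ᶠ first s) (neq ∘ sym) ⟩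
    false                      ∎) λ ()
    where open ≡-Reasoning

module Exact {A : Set} (_∙_ : A → A → A) (ids : Identities _∙_)
             (to-z2op : ∀ {n} (s t : Term n) → SameOp _∙_ s t → SameOp z2op s t) where
  open Bounds _∙_ ids using (bracketings-atMost; fullLinear-atMost)

  bracketings-exact : ∀ {n} (w : List (Fin n)) → 3 ≤ length w → SpecEq _∙_ (HasLeaves w) 2
  bracketings-exact w 3≤∣w∣ =
    bracketings-atMost w 3≤∣w∣ ,
    atLeast _∙_ (HasLeaves w) parityBit (bracketing-section w 3≤∣w∣)
      λ s t same → cong bit (proj₁ (z2op-separates s t (to-z2op s t same)))

  fullLinear-exact : ∀ {n} → 3 ≤ n → SpecEq _∙_ (IsFullLinear {n}) (2 * n)
  fullLinear-exact 3≤n =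
    fullLinear-atMost 3≤n ,
    atLeast _∙_ IsFullLinear shapeCode (fullLinear-section 3≤n)
      λ s t same → let parity≡ , first≡ = z2op-separates s t (to-z2op s t same)
                   in cong₂ combine (cong bit parity≡) first≡

  exact : ∀ n → 3 ≤ n → sₙ≡ _∙_ n 2 × sᵃᶜₙ≡ _∙_ n (2 * n)
  exact n 3≤n = bracketings-exact (allFin n) (3≤∣allFin∣ 3≤n) , fullLinear-exact 3≤n

module _ {A : Set} {_∙_ _⋆_ : A → A → A} (⋆-flip : ∀ x y → x ⋆ y ≡ y ∙ x)
         {n} {P Q : Term n → Set}
         (P⇒Q : ∀ t → P t → Q (mirror t)) (Q⇒P : ∀ t → Q t → P (mirror t)) where

  SpecEq-mirror : ∀ {k} → SpecEq _∙_ Q k → SpecEq _⋆_ P k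
  SpecEq-mirror ((ts , Q-ts , cover) , (us , Q-us , distinct)) =
    (mirror ∘ ts , (λ i → Q⇒P _ (Q-ts i)) , cover′) ,
    (mirror ∘ us , (λ i → Q⇒P _ (Q-us i)) , distinct′)
    where
    cover′ : ∀ t → P t → Σ[ i ∈ Fin _ ] SameOp _⋆_ t (mirror (ts i))
    cover′ t Pt with cover (mirror t) (P⇒Q t Pt)
    ... | i , same = i , λ ρ → trans (sym (⟦mirror⟧ (λ x y → sym (⋆-flip y x)) t ρ))
                                     (trans (same ρ) (sym (⟦mirror⟧ ⋆-flip (ts i) ρ)))
    distinct′ : ∀ i j → i ≢ j → ¬ SameOp _⋆_ (mirror (us i)) (mirror (us j))
    distinct′ i j i≢j same = distinct i j i≢j λ ρ →
      trans (sym (⟦mirror⟧ ⋆-flip (us i) ρ)) (trans (same ρ) (⟦mirror⟧ ⋆-flip (us j) ρ))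

module SC189 = Exact sc189 (from-yes (identities? sc189))
  (SameOp-reflect {_⋆_ = sc189} suc fsuc-injective
    (from-yes (all? λ x → all? λ y → suc (z2op x y) ≟ᶠ sc189 (suc x) (suc y))))

-- Mirroring turns the bracketings of x₁⋯xₙ into those of xₙ⋯x₁.
sc170-exact : ∀ n → 3 ≤ n → sₙ≡ sc170 n 2 × sᵃᶜₙ≡ sc170 n (2 * n)
sc170-exact n 3≤n =
  SpecEq-mirror sc170-flip bracketing⇒reversed reversed⇒bracketing
    (SC189.bracketings-exact (reverse (allFin n))
      (subst (3 ≤_) (sym (length-reverse (allFin n))) (3≤∣allFin∣ 3≤n))) ,
  SpecEq-mirror sc170-flip fullLinear-mirror fullLinear-mirror (SC189.fullLinear-exact 3≤n)
  where
  sc170-flip : ∀ x y → sc170 x y ≡ sc189 y x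
  sc170-flip = from-yes (all? λ x → all? λ y → sc170 x y ≟ᶠ sc189 y x)
  bracketing⇒reversed : ∀ t → HasLeaves (allFin n) t → HasLeaves (reverse (allFin n)) (mirror t)
  bracketing⇒reversed t t∈ = trans (leaves-mirror t) (cong reverse t∈)
  reversed⇒bracketing : ∀ t → HasLeaves (reverse (allFin n)) t → HasLeaves (allFin n) (mirror t)
  reversed⇒bracketing t t∈ =
    trans (leaves-mirror t) (trans (cong reverse t∈) (reverse-involutive (allFin n)))
  fullLinear-mirror : ∀ t → IsFullLinear t → IsFullLinear (mirror t)
  fullLinear-mirror t t∈ =
    ↭-trans (↭-reflexive (leaves-mirror t)) (↭-trans (↭-reverse (leaves t)) t∈)

proposition3p4 :
    ((A : Set) (_∙_ : A → A → A) → Identities _∙_ → (n : ℕ) → 3 ≤ n →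
      sₙ≤ _∙_ n 2 × sᵃᶜₙ≤ _∙_ n (2 * n) ×
      (sᵃᶜₙ≡ _∙_ n (2 * n) → sₙ≡ _∙_ n 2)) ×
    ((n : ℕ) → 3 ≤ n → sₙ≡ z2op n 2 × sᵃᶜₙ≡ z2op n (2 * n)) ×
    ((n : ℕ) → 3 ≤ n → sₙ≡ sc170 n 2 × sᵃᶜₙ≡ sc170 n (2 * n)) ×
    ((n : ℕ) → 3 ≤ n → sₙ≡ sc189 n 2 × sᵃᶜₙ≡ sc189 n (2 * n))
proposition3p4 =
  (λ _ _∙_ ids → Bounds.bounds _∙_ ids) ,
  Exact.exact z2op (from-yes (identities? z2op)) (λ _ _ same → same) ,
  sc170-exact ,
  SC189.exact
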